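{- For every term $M$ and all continuations $K_1, K_2$, $\underline{K_1}[\underline{K_2}[M]]=\underline{K_2[k:=K_1]}[M]$.
   Context: Syntax. Fix a ring of scalars; $\alpha$ ranges over it. Terms: $M,N ::= V \mid MN \mid \alpha.M \mid M+N$; values $V,W ::= B \mid 0 \mid \alpha.V \mid V+W$; base values $B ::= x \mid \lambda x.M$. Terms are taken up to $\alpha$-conversion and $M[x:=N]$ is capture-avoiding substitution. CPS grammar. Base computations $C ::= KB \mid BSK \mid TK$; computation combinations $D ::= C \mid 0 \mid \alpha.D \mid D_1+D_2$; base suspensions $S ::= x \mid \lambda k.C$; suspension combinations $T ::= S \mid 0 \mid \alpha.T \mid T_1+T_2$; continuations $K ::= k \mid \lambda b.bSK$; CPS-values $B ::= \lambda x.S$. Here $x$ ranges over ordinary variables, $k,b$ are reserved variables; $k$ occurs only as the continuation $k$ and as the binder in $\lambda k.C$; $b$ occurs only where displayed. Inverse translation: $\overline{KB}=\underline{K}[\phi(B)]$; $\overline{BSK}=\underline{K}[\phi(B)\sigma(S)]$; $\overline{TK}=\underline{K}[\sigma(T)]$; $\overline{0}=0$; $\overline{\alpha.D}=\alpha.\overline{D}$; $\overline{D_1+D_2}=\overline{D_1}+\overline{D_2}$; $\sigma(x)=x$; $\sigma(\lambda k.C)=\overline{C}$; $\sigma(0)=0$; $\sigma(\alpha.T)=\alpha.\sigma(T)$; $\sigma(T_1+T_2)=\sigma(T_1)+\sigma(T_2)$; $\phi(\lambda x.S)=\lambda x.\sigma(S)$; for a term $M$: $\underline{k}[M]=M$;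 $\underline{\lambda b.bSK}[M]=\underline{K}[M\,\sigma(S)]$. -}

module Defs where

open import Level using (Level)
open import Data.Nat using (ℕ)
open import Algebra.Bundles using (Ring)

module Syntax {c ℓ : Level} (R : Ring c ℓ) where
  open Ring R using (Carrier)

  Scalar = Carrier

  -- Terms of the algebraic lambda calculus, with de Bruijn indices for
  -- ordinary variables (so syntactic equality = alpha-equivalence).
  -- M ::= x | λx.M | M N | 0 | α.M | M + N
  data Term : Set c where
    var  : ℕ → Term
    lam  : Term → Term
    app  : Term → Term → Term
    zero : Term
    smul : Scalar → Term → Term
    plus : Term → Term → Term

  -- CPS grammar.  Ordinary variables x are de Bruijn indices; the
  -- reserved variables k and b are not ordinary variables, so they are
  -- represented by dedicated constructors.
  mutual
    data Comp : Set c where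
      kB  : Cont → CVal → Comp
      bSK : CVal → Susp → Cont → Comp
      tK  : SuspC → Cont → Comp

    data Susp : Set c where
      svar : ℕ → Susp
      slamk : Comp → Susp

    data SuspC : Set c where
      susp  : Susp → SuspC
      tzero : SuspC
      tsmul : Scalar → SuspC → SuspC
      tplus : SuspC → SuspC → SuspC

    -- continuations  K ::= k | λb.b S K
    data Cont : Set c where
      k    : Cont
      lamb : Susp → Cont → Cont

    data CVal : Set c where
      clam : Susp → CVal

  data CompC : Set c where
    comp  : Comp → CompC
    dzero : CompC
    dsmul : Scalar → CompC → CompC
    dplus : CompC → CompC → CompC

  -- Inside λb.bSK, the suspension S is either a variable x or λk.C,
  -- where k is bound, so k has no free occurrence in S and the
  -- substitution only acts on the tail continuation.
  _[k:=_] : Cont → Cont → Cont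
  k          [k:= K' ] = K'
  (lamb S K) [k:= K' ] = lamb S (K [k:= K' ])

  mutual
    ‾ : Comp → Term
    ‾ (kB K B)    = plug K (φ B)
    ‾ (bSK B S K) = plug K (app (φ B) (σ S))
    ‾ (tK T K)    = plug K (σT T)

    σ : Susp → Term
    σ (svar x)  = var x
    σ (slamk C) = ‾ C

    σT : SuspC → Term
    σT (susp S)      = σ S
    σT tzero         = zero
    σT (tsmul a T)   = smul a (σT T)
    σT (tplus T₁ T₂) = plus (σT T₁) (σT T₂)

    φ : CVal → Term
    φ (clam S) = lam (σ S)

    -- underline K [ M ]
    plug : Cont → Term → Term
    plug k          M = M
    plug (lamb S K) M = plug K (app M (σ S))

  ‾D : CompC → Term
  ‾D (comp C)      = ‾ C
  ‾D dzero         = zero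
  ‾D (dsmul a D)   = smul a (‾D D)
  ‾D (dplus D₁ D₂) = plus (‾D D₁) (‾D D₂)

-- A continuation K denotes the term context K[-] ("plug K"): the
-- continuation variable k is the hole, and λb.b S K' applies the hole to
-- σ(S) and continues with K'.  Substituting K₁ for k in K₂ grafts K₁ onto
-- the tail of K₂, so the theorem says that the context of K₂[k:=K₁] is the
-- composite of the contexts of K₂ and K₁.
module Submission where

open import Defs
open import Level using (Level)
open import Algebra.Bundles using (Ring)
open import Relation.Binary.PropositionalEquality using (_≡_; refl)

module Composition {c ℓ : Level} (R : Ring c ℓ) where
  open Syntax R

  plug-[k:=] : (M : Term) (K₁ K₂ : Cont) →
    plug K₁ (plug K₂ M) ≡ plug (K₂ [k:= K₁ ]) M
  plug-[k:=] M K₁ k          = refl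
  plug-[k:=] M K₁ (lamb S K) = plug-[k:=] (app M (σ S)) K₁ K

lemma4p9 : {c ℓ : Level} (R : Ring c ℓ) →
    let open Syntax R in
    (M : Term) (K₁ K₂ : Cont) →
      plug K₁ (plug K₂ M) ≡ plug (K₂ [k:= K₁ ]) M
lemma4p9 R = Composition.plug-[k:=] R
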